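{- Let $n=p^{m_1}q^{m_2}$, where $p<q$ are distinct primes and $m_1,m_2$ are positive integers. Then the Wiener index of the essential ideal graph $\mathcal{E}_{\mathbb{Z}_n}$ is $$W(\mathcal{E}_{\mathbb{Z}_n})=\tfrac12\big[m_1m_2(m_1m_2-1)+(m_1+m_2)(2m_1m_2-4)+2(1+m_1^2+m_2^2)\big].$$
   Context: $\mathbb{Z}_n$ is the ring of integers modulo $n$. An ideal $I$ of a commutative ring $R$ is essential if $I\cap J\neq\{0\}$ for every nonzero ideal $J$ of $R$. The essential ideal graph $\mathcal{E}_{\mathbb{Z}_n}$ is the simple graph whose vertex set is the set of all nonzero proper ideals of $\mathbb{Z}_n$, two distinct vertices $I,K$ being adjacent if and only if $I+K$ is an essential ideal of $\mathbb{Z}_n$. For a connected graph $G$ with distance $d$, the Wiener index is $W(G)=\sum_{\{u,v\}} d(u,v)$, summed over unordered pairs of distinct vertices. -}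

module Defs where

open import Data.Bool using (Bool; true; false; _∧_; _∨_; not; if_then_else_)
open import Data.Nat using (ℕ; zero; suc; _+_; _∸_; _≡ᵇ_)
open import Data.Nat.DivMod using (_mod_)
open import Data.Fin using (Fin; toℕ)
open import Data.Fin.Subset using (Subset; _∩_)
open import Data.Nat.ListAction using (sum)
open import Data.List using (List; []; _∷_; filter; map; length; _++_)
import Data.List as L
open import Data.Bool.ListAction using (and; or)
open import Data.Vec using (Vec; []; _∷_; lookup; tabulate)
open import Data.Fin.Base using () renaming (zero to fz)
open import Data.List.Base using (allFin)
open import Relation.Nullary.Decidable using (T?)

private
  variable n : ℕ

0ᶻ : Fin (suc n)
0ᶻ = fz

_+ᶻ_ : Fin n → Fin n → Fin n
_+ᶻ_ {suc k} a b = (toℕ a + toℕ b) mod suc k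

-ᶻ_ : Fin n → Fin n
-ᶻ_ {suc k} a = (suc k ∸ toℕ a) mod suc k

_*ᶻ_ : Fin n → Fin n → Fin n
_*ᶻ_ {suc k} a b = (toℕ a Data.Nat.* toℕ b) mod suc k

_==_ : Fin n → Fin n → Bool
a == b = toℕ a ≡ᵇ toℕ b

isZeroElt : Fin n → Bool
isZeroElt a = toℕ a ≡ᵇ 0

allZ : (Fin n → Bool) → Bool
allZ {n} P = and (map P (allFin n))

anyZ : (Fin n → Bool) → Bool
anyZ {n} P = or (map P (allFin n))

allL : {A : Set} → List A → (A → Bool) → Bool
allL xs P = and (map P xs)

anyL : {A : Set} → List A → (A → Bool) → Bool
anyL xs P = or (map P xs)

infix 8 _∈ᵇ_
infixr 5 _⇒ᵇ_
infix 8 _==_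

_∈ᵇ_ : Fin n → Subset n → Bool
a ∈ᵇ I = lookup I a

_⇒ᵇ_ : Bool → Bool → Bool
a ⇒ᵇ b = not a ∨ b

eqSubset : Subset n → Subset n → Bool
eqSubset {n} I K = allZ {n} (λ a → (a ∈ᵇ I ⇒ᵇ a ∈ᵇ K) ∧ (a ∈ᵇ K ⇒ᵇ a ∈ᵇ I))

allSubsets : (n : ℕ) → List (Subset n)
allSubsets zero = [] ∷ []
allSubsets (suc n) = map (true ∷_) (allSubsets n) ++ map (false ∷_) (allSubsets n)

isIdeal : Subset n → Bool
isIdeal {zero} I = false   -- ℤ_0 is not considered (n ≥ 1 throughout)
isIdeal {suc k} I =
  (0ᶻ ∈ᵇ I)
  ∧ allZ (λ a → allZ (λ b → (a ∈ᵇ I ∧ b ∈ᵇ I) ⇒ᵇ ((a +ᶻ b) ∈ᵇ I)))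
  ∧ allZ (λ a → a ∈ᵇ I ⇒ᵇ ((-ᶻ a) ∈ᵇ I))
  ∧ allZ (λ r → allZ (λ a → a ∈ᵇ I ⇒ᵇ ((r *ᶻ a) ∈ᵇ I)))

ideals : (n : ℕ) → List (Subset n)
ideals n = filter (λ I → T? (isIdeal I)) (allSubsets n)

isNonzero : Subset n → Bool
isNonzero I = anyZ (λ a → a ∈ᵇ I ∧ not (isZeroElt a))

isProper : Subset n → Bool
isProper I = anyZ (λ a → not (a ∈ᵇ I))

_⊕_ : Subset n → Subset n → Subset n
I ⊕ K = tabulate (λ c → anyZ (λ a → anyZ (λ b → a ∈ᵇ I ∧ b ∈ᵇ K ∧ ((a +ᶻ b) == c))))

isEssential : Subset n → Bool
isEssential {n} I = allL (ideals n) (λ J → isNonzero J ⇒ᵇ isNonzero (I ∩ J))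

vertices : (n : ℕ) → List (Subset n)
vertices n = filter (λ I → T? (isNonzero I ∧ isProper I)) (ideals n)

adj : Subset n → Subset n → Bool
adj I K = not (eqSubset I K) ∧ isEssential (I ⊕ K)

walkWithin : (n : ℕ) → ℕ → Subset n → Subset n → Bool
walkWithin n zero u v = eqSubset u v
walkWithin n (suc k) u v =
  walkWithin n k u v ∨ anyL (vertices n) (λ w → walkWithin n k u w ∧ adj w v)

-- graph distance: least k with a walk of length ≤ k from u to v,
-- searched up to the number of vertices (sufficient for connected graphs)
dist : (n : ℕ) → Subset n → Subset n → ℕ
dist n u v = search 0 (length (vertices n))
  where
  search : ℕ → ℕ → ℕ
  search k zero = k
  search k (suc f) = if walkWithin n k u v then k else search (suc k) f

pairSum : {A : Set} → (A → A → ℕ) → List A → ℕ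
pairSum d [] = 0
pairSum d (x ∷ xs) = sum (map (d x) xs) + pairSum d xs

wienerEssential : ℕ → ℕ
wienerEssential n = pairSum (dist n) (vertices n)

-- Every ideal of ℤ_n is the set of multiples of a divisor of n, so for n = p^m₁ q^m₂ the
-- vertices are the ideals (p^a q^b) with (a , b) in the box [0, m₁] × [0, m₂] minus its two
-- corners. A sum of two such ideals is essential unless both lie in (p^m₁) or both lie in
-- (q^m₂): otherwise it contains p^(m₁-1) q^m₂ and p^m₁ q^(m₂-1), one of which lies in every
-- nonzero ideal. Two ideals inside (p^m₁) are both adjacent to (q^m₂), and symmetrically, so
-- all distances are 1 except for the C(m₂,2) + C(m₁,2) pairs inside (p^m₁) or inside (q^m₂),
-- which are at distance 2. With N = m₁m₂ + m₁ + m₂ - 1 vertices,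
-- W = C(N,2) + C(m₁,2) + C(m₂,2), which rearranges to the stated formula.

module Submission where

open import Defs
open import Data.Bool using (Bool; true; false; _∧_; _∨_; not)
open import Data.Bool.Properties using (∧-conicalˡ; ∧-conicalʳ; ∨-zeroʳ; T-≡)
open import Data.Empty using (⊥-elim)
open import Data.Fin as Fin using (Fin; toℕ; fromℕ<)
open import Data.Fin.Properties using (toℕ-fromℕ<; toℕ-injective; toℕ<n)
open import Data.Fin.Subset using (Subset; _∩_)
open import Data.Integer using (+_) renaming (_+_ to _+ℤ_; _*_ to _*ℤ_; _-_ to _-ℤ_)
open import Data.Integer.Properties using (pos-+; pos-*)
import Data.Integer.Tactic.RingSolver as IntegerSolver
open import Data.List using (List; []; _∷_; allFin; map; _++_; length; upTo; drop; cartesianProduct)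
open import Data.List.Membership.Propositional using (_∈_)
open import Data.List.Membership.Propositional.Properties
  using (∈-allFin; ∈-++⁺ˡ; ∈-++⁺ʳ; ∈-++⁻; ∈-map⁺; ∈-map⁻; ∈-filter⁺; ∈-filter⁻; ∈-upTo⁺; ∈-upTo⁻; ∈-cartesianProduct⁺; ∈-cartesianProduct⁻)
open import Data.List.Membership.Propositional.Properties.WithK using (unique∧set⇒bag)
open import Data.List.Properties using (map-++; map-∘; length-++; length-map; length-upTo)
open import Data.List.Relation.Binary.BagAndSetEquality using (∼bag⇒↭)
open import Data.List.Relation.Binary.Permutation.Propositional as ↭ using (_↭_)
import Data.List.Relation.Binary.Permutation.Propositional.Properties as Perm
import Data.List.Relation.Unary.All as All
open import Data.List.Relation.Unary.AllPairs using ([]; _∷_)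
open import Data.List.Relation.Unary.Any using (here; there)
open import Data.List.Relation.Unary.Unique.Propositional using (Unique)
import Data.List.Relation.Unary.Unique.Propositional.Properties as Unique
open import Data.Nat using (ℕ; zero; suc; _+_; _*_; _∸_; _^_; _≤_; _<_; z≤n; s≤s; s≤s⁻¹; pred; _≡ᵇ_; NonZero; ≢-nonZero⁻¹)
open import Data.Nat.Coprimality using (Coprime; coprime-divisor)
open import Data.Nat.DivMod
  using (_%_; _/_; _mod_; m%n<n; m<n⇒m%n≡m; n%n≡0; %-distribˡ-+; %-distribˡ-*; %-remove-+ʳ; m/n*n≤m; m%n≡m∸m/n*n; m≡m%n+[m/n]*n)
open import Data.Nat.Divisibility
open import Data.Nat.ListAction using (sum)
open import Data.Nat.ListAction.Properties using (sum-++; sum-↭)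
open import Data.Nat.Primality using (Prime; euclidsLemma; prime⇒irreducible; prime⇒nonZero; ¬prime[1])
open import Data.Nat.Properties
open import Data.Nat.Tactic.RingSolver using (solve-∀)
open import Data.Product using (∃; ∃₂; _×_; _,_; proj₁; proj₂)
import Data.Product as Prod
open import Data.Product.Properties using (×-≡,≡→≡; ≡-dec)
open import Data.Sum as Sum using (_⊎_; inj₁; inj₂; [_,_]′)
open import Data.Vec using ([]; _∷_; lookup; tabulate)
open import Data.Vec.Properties using (∷-injectiveˡ; ∷-injectiveʳ; lookup∘tabulate; lookup-zipWith; tabulate∘lookup; tabulate-cong)
open import Function.Base using (_∘′_; case_of_)
open import Function.Bundles using (Equivalence; mk⇔)
open import Relation.Nullary using (¬_; yes; no; does)
open import Relation.Nullary.Decidable using (T?)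
open import Relation.Binary.PropositionalEquality

⇒ᵇ-intro : ∀ {a b} → (a ≡ true → b ≡ true) → a ⇒ᵇ b ≡ true
⇒ᵇ-intro {true} h = h refl
⇒ᵇ-intro {false} h = refl

⇒ᵇ-elim : ∀ {a b} → a ⇒ᵇ b ≡ true → a ≡ true → b ≡ true
⇒ᵇ-elim {true} h refl = h

true⇔true⇒≡ : ∀ {a b} → (a ≡ true → b ≡ true) → (b ≡ true → a ≡ true) → a ≡ b
true⇔true⇒≡ {true} f g = sym (f refl)
true⇔true⇒≡ {false} {true} f g = g refl
true⇔true⇒≡ {false} {false} f g = refl

module _ {A : Set} (P : A → Bool) where

  allL⁺ : ∀ xs → (∀ {x} → x ∈ xs → P x ≡ true) → allL xs P ≡ true
  allL⁺ [] h = refl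
  allL⁺ (x ∷ xs) h = cong₂ _∧_ (h (here refl)) (allL⁺ xs (λ m → h (there m)))

  allL⁻ : ∀ {xs x} → allL xs P ≡ true → x ∈ xs → P x ≡ true
  allL⁻ {y ∷ xs} h (here refl) = ∧-conicalˡ (P y) _ h
  allL⁻ {y ∷ xs} h (there m) = allL⁻ (∧-conicalʳ (P y) _ h) m

  allL-false : ∀ {xs x} → x ∈ xs → P x ≡ false → allL xs P ≡ false
  allL-false {y ∷ xs} (here refl) e rewrite e = refl
  allL-false {y ∷ xs} (there m) e with P y
  ... | true = allL-false m e
  ... | false = refl

  anyL⁺ : ∀ {xs x} → x ∈ xs → P x ≡ true → anyL xs P ≡ true
  anyL⁺ {y ∷ xs} (here refl) e rewrite e = refl
  anyL⁺ {y ∷ xs} (there m) e with P y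
  ... | true = refl
  ... | false = anyL⁺ m e

  anyL⁻ : ∀ xs → anyL xs P ≡ true → ∃ λ x → x ∈ xs × P x ≡ true
  anyL⁻ (y ∷ xs) h with P y in eq
  ... | true = y , here refl , eq
  ... | false = let x , m , e = anyL⁻ xs h in x , there m , e

  anyL-false : ∀ xs → (∀ {x} → x ∈ xs → P x ≡ false) → anyL xs P ≡ false
  anyL-false [] h = refl
  anyL-false (x ∷ xs) h rewrite h (here refl) = anyL-false xs (λ m → h (there m))

module _ {n : ℕ} (P : Fin n → Bool) where

  allZ⁺ : (∀ a → P a ≡ true) → allZ P ≡ true
  allZ⁺ h = allL⁺ P (allFin n) (λ {a} _ → h a)

  allZ⁻ : allZ P ≡ true → ∀ a → P a ≡ true
  allZ⁻ h a = allL⁻ P h (∈-allFin a)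

  anyZ⁺ : ∀ a → P a ≡ true → anyZ P ≡ true
  anyZ⁺ a = anyL⁺ P (∈-allFin a)

  anyZ⁻ : anyZ P ≡ true → ∃ λ a → P a ≡ true
  anyZ⁻ h = let a , _ , e = anyL⁻ P (allFin n) h in a , e

  anyZ-false : (∀ a → P a ≡ false) → anyZ P ≡ false
  anyZ-false h = anyL-false P (allFin n) (λ {a} _ → h a)

subset-ext : ∀ {n} {I K : Subset n} → (∀ a → a ∈ᵇ I ≡ a ∈ᵇ K) → I ≡ K
subset-ext {I = I} {K} h = trans (sym (tabulate∘lookup I)) (trans (tabulate-cong h) (tabulate∘lookup K))

eqSubset⇒≡ : ∀ {n} {I K : Subset n} → eqSubset I K ≡ true → I ≡ K
eqSubset⇒≡ {I = I} {K} e = subset-ext λ a →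
  let both = allZ⁻ _ e a in
  true⇔true⇒≡ (⇒ᵇ-elim (∧-conicalˡ _ _ both)) (⇒ᵇ-elim (∧-conicalʳ (a ∈ᵇ I ⇒ᵇ a ∈ᵇ K) _ both))

eqSubset-refl : ∀ {n} (I : Subset n) → eqSubset I I ≡ true
eqSubset-refl I = allZ⁺ _ λ a → both (a ∈ᵇ I)
  where
  both : ∀ b → (b ⇒ᵇ b) ∧ (b ⇒ᵇ b) ≡ true
  both true = refl
  both false = refl

eqSubset-≢ : ∀ {n} {I K : Subset n} → I ≢ K → eqSubset I K ≡ false
eqSubset-≢ {I = I} {K} I≢K with eqSubset I K in eq
... | true = ⊥-elim (I≢K (eqSubset⇒≡ eq))
... | false = refl

allSubsets-complete : ∀ n (I : Subset n) → I ∈ allSubsets n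
allSubsets-complete zero [] = here refl
allSubsets-complete (suc n) (true ∷ I) = ∈-++⁺ˡ (∈-map⁺ (true ∷_) (allSubsets-complete n I))
allSubsets-complete (suc n) (false ∷ I) = ∈-++⁺ʳ (map (true ∷_) (allSubsets n)) (∈-map⁺ (false ∷_) (allSubsets-complete n I))

allSubsets-unique : ∀ n → Unique (allSubsets n)
allSubsets-unique zero = All.[] ∷ []
allSubsets-unique (suc n) =
  Unique.++⁺ (Unique.map⁺ ∷-injectiveʳ (allSubsets-unique n)) (Unique.map⁺ ∷-injectiveʳ (allSubsets-unique n))
    λ (I∈true , I∈false) → let _ , _ , I≡ = ∈-map⁻ (true ∷_) I∈true
                               _ , _ , I≡′ = ∈-map⁻ (false ∷_) I∈false
                           in true≢false (∷-injectiveˡ (trans (sym I≡) I≡′))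
  where
  true≢false : true ≢ false
  true≢false ()

∈-ideals⁺ : ∀ {n} {I : Subset n} → isIdeal I ≡ true → I ∈ ideals n
∈-ideals⁺ {n} {I} I-ideal = ∈-filter⁺ (λ I → T? (isIdeal I)) (allSubsets-complete n I) (Equivalence.from T-≡ I-ideal)

∈-ideals⁻ : ∀ {n} {I : Subset n} → I ∈ ideals n → isIdeal I ≡ true
∈-ideals⁻ {n} I∈ = Equivalence.to T-≡ (proj₂ (∈-filter⁻ (λ I → T? (isIdeal I)) {xs = allSubsets n} I∈))

∈-vertices⁺ : ∀ {n} {I : Subset n} → isIdeal I ≡ true → isNonzero I ≡ true → isProper I ≡ true → I ∈ vertices n
∈-vertices⁺ I-ideal I≠0 I-proper =
  ∈-filter⁺ (λ I → T? (isNonzero I ∧ isProper I)) (∈-ideals⁺ I-ideal) (Equivalence.from T-≡ (cong₂ _∧_ I≠0 I-proper))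

∈-vertices⁻ : ∀ {n} {I : Subset n} → I ∈ vertices n → isIdeal I ≡ true × isNonzero I ≡ true × isProper I ≡ true
∈-vertices⁻ {n} {I} I∈ =
  let I∈ideals , nonzero∧proper = ∈-filter⁻ (λ I → T? (isNonzero I ∧ isProper I)) {xs = ideals n} I∈
      both = Equivalence.to T-≡ nonzero∧proper
  in ∈-ideals⁻ I∈ideals , ∧-conicalˡ _ _ both , ∧-conicalʳ (isNonzero I) _ both

nonzero⁺ : ∀ {n} {I : Subset n} a → a ∈ᵇ I ≡ true → toℕ a ≢ 0 → isNonzero I ≡ true
nonzero⁺ {I = I} a a∈ a≢0 = anyZ⁺ (λ a → a ∈ᵇ I ∧ not (isZeroElt a)) a (cong₂ _∧_ a∈ (≢0⇒not-≡ᵇ0 a≢0))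
  where
  ≢0⇒not-≡ᵇ0 : ∀ {x} → x ≢ 0 → not (x ≡ᵇ 0) ≡ true
  ≢0⇒not-≡ᵇ0 {zero} x≢0 = ⊥-elim (x≢0 refl)
  ≢0⇒not-≡ᵇ0 {suc x} _ = refl

nonzero-false : ∀ {n} {I : Subset n} → (∀ a → a ∈ᵇ I ≡ true → toℕ a ≡ 0) → isNonzero I ≡ false
nonzero-false {I = I} only0 = anyZ-false (λ a → a ∈ᵇ I ∧ not (isZeroElt a)) no-witness
  where
  no-witness : ∀ a → a ∈ᵇ I ∧ not (isZeroElt a) ≡ false
  no-witness a with a ∈ᵇ I in a∈
  ... | false = refl
  ... | true rewrite only0 a a∈ = refl

∈-∩ : ∀ {n} (I K : Subset n) a → a ∈ᵇ (I ∩ K) ≡ a ∈ᵇ I ∧ a ∈ᵇ K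
∈-∩ I K a = lookup-zipWith _∧_ a I K

essential⁺ : ∀ {n} {S : Subset n} → (∀ {J} → J ∈ ideals n → isNonzero J ≡ true → isNonzero (S ∩ J) ≡ true) →
  isEssential S ≡ true
essential⁺ {n} {S} h = allL⁺ (λ J → isNonzero J ⇒ᵇ isNonzero (S ∩ J)) (ideals n) λ J∈ → ⇒ᵇ-intro (h J∈)

essential-false : ∀ {n} {S J : Subset n} → J ∈ ideals n → isNonzero J ≡ true →
  (∀ a → a ∈ᵇ S ≡ true → a ∈ᵇ J ≡ true → toℕ a ≡ 0) → isEssential S ≡ false
essential-false {n} {S} {J} J∈ J≠0 disjoint = allL-false (λ J → isNonzero J ⇒ᵇ isNonzero (S ∩ J)) J∈ S∩J=0
  where
  S∩J=0 : isNonzero J ⇒ᵇ isNonzero (S ∩ J) ≡ false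
  S∩J=0 rewrite J≠0 | nonzero-false {I = S ∩ J} (λ a a∈ → let both = trans (sym (∈-∩ S J a)) a∈ in
                        disjoint a (∧-conicalˡ _ _ both) (∧-conicalʳ (a ∈ᵇ S) _ both)) = refl

-- Ideals of ℤ_n

least-true-≤ : (P : ℕ → Bool) (m : ℕ) →
  (∃ λ d → d ≤ m × P d ≡ true × (∀ e → e < d → P e ≡ false)) ⊎ (∀ e → e ≤ m → P e ≡ false)
least-true-≤ P zero with P 0 in eq
... | true = inj₁ (0 , z≤n , eq , λ _ ())
... | false = inj₂ λ { zero _ → eq }
least-true-≤ P (suc m) with least-true-≤ P m
... | inj₁ (d , d≤m , Pd , below) = inj₁ (d , m≤n⇒m≤1+n d≤m , Pd , below)
... | inj₂ none with P (suc m) in eq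
...   | true = inj₁ (suc m , ≤-refl , eq , λ e e<1+m → none e (s≤s⁻¹ e<1+m))
...   | false = inj₂ λ e e≤1+m → [ (λ e<1+m → none e (s≤s⁻¹ e<1+m)) , (λ { refl → eq }) ]′ (m≤n⇒m<n∨m≡n e≤1+m)

module Residues (k : ℕ) where

  n : ℕ
  n = suc k

  multiples : ℕ → Subset n
  multiples g = tabulate (λ a → does (g ∣? toℕ a))

  ∈-multiples⁺ : ∀ {g} (a : Fin n) → g ∣ toℕ a → a ∈ᵇ multiples g ≡ true
  ∈-multiples⁺ {g} a g∣a rewrite lookup∘tabulate (λ a → does (g ∣? toℕ a)) a with g ∣? toℕ a
  ... | yes _ = refl
  ... | no g∤a = ⊥-elim (g∤a g∣a)

  ∈-multiples⁻ : ∀ {g} (a : Fin n) → a ∈ᵇ multiples g ≡ true → g ∣ toℕ a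
  ∈-multiples⁻ {g} a e rewrite lookup∘tabulate (λ a → does (g ∣? toℕ a)) a with g ∣? toℕ a
  ... | yes g∣a = g∣a

  ∉-multiples : ∀ {g} (a : Fin n) → ¬ g ∣ toℕ a → a ∈ᵇ multiples g ≡ false
  ∉-multiples {g} a g∤a with a ∈ᵇ multiples g in eq
  ... | true = ⊥-elim (g∤a (∈-multiples⁻ a eq))
  ... | false = refl

  toℕ-mod : ∀ x → toℕ (x mod n) ≡ x % n
  toℕ-mod x = toℕ-fromℕ< (m%n<n x n)

  toℕ-mod-toℕ : ∀ (a : Fin n) → toℕ a mod n ≡ a
  toℕ-mod-toℕ a = toℕ-injective (trans (toℕ-mod (toℕ a)) (m<n⇒m%n≡m (toℕ<n a)))

  mod-cong : ∀ x y → x % n ≡ y % n → x mod n ≡ y mod n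
  mod-cong x y e = toℕ-injective (trans (toℕ-mod x) (trans e (sym (toℕ-mod y))))

  ∣-% : ∀ {g} x → g ∣ n → g ∣ x → g ∣ x % n
  ∣-% {g} x g∣n g∣x = ∣m+n∣m⇒∣n (subst (g ∣_) (trans (m≡m%n+[m/n]*n x n) (+-comm (x % n) _)) g∣x) (∣n⇒∣m*n (x / n) g∣n)

  _∈ℕ_ : ℕ → Subset n → Bool
  x ∈ℕ I = (x mod n) ∈ᵇ I

  ∈ℕ-toℕ : ∀ (I : Subset n) a → a ∈ᵇ I ≡ toℕ a ∈ℕ I
  ∈ℕ-toℕ I a = cong (lookup I) (sym (toℕ-mod-toℕ a))

  ∈ℕ-cong : ∀ (I : Subset n) x y → x % n ≡ y % n → x ∈ℕ I ≡ y ∈ℕ I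
  ∈ℕ-cong I x y e = cong (lookup I) (mod-cong x y e)

  module Ideal (I : Subset n) (I-ideal : isIdeal I ≡ true) where

    private
      +-axiom neg-axiom *-axiom : Bool
      +-axiom = allZ (λ a → allZ (λ b → (a ∈ᵇ I ∧ b ∈ᵇ I) ⇒ᵇ ((a +ᶻ b) ∈ᵇ I)))
      neg-axiom = allZ (λ a → a ∈ᵇ I ⇒ᵇ ((-ᶻ a) ∈ᵇ I))
      *-axiom = allZ (λ r → allZ (λ a → a ∈ᵇ I ⇒ᵇ ((r *ᶻ a) ∈ᵇ I)))

      axioms : +-axiom ∧ neg-axiom ∧ *-axiom ≡ true
      axioms = ∧-conicalʳ (0ᶻ ∈ᵇ I) _ I-ideal

    +-closed : ∀ a b → a ∈ᵇ I ≡ true → b ∈ᵇ I ≡ true → (a +ᶻ b) ∈ᵇ I ≡ true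
    +-closed a b a∈ b∈ = ⇒ᵇ-elim (allZ⁻ _ (allZ⁻ _ (∧-conicalˡ +-axiom _ axioms) a) b) (cong₂ _∧_ a∈ b∈)

    *-closed : ∀ r a → a ∈ᵇ I ≡ true → (r *ᶻ a) ∈ᵇ I ≡ true
    *-closed r a a∈ = ⇒ᵇ-elim (allZ⁻ _ (allZ⁻ _ *-holds r) a) a∈
      where
      *-holds : *-axiom ≡ true
      *-holds = ∧-conicalʳ neg-axiom *-axiom (∧-conicalʳ +-axiom _ axioms)

    0∈ℕ : 0 ∈ℕ I ≡ true
    0∈ℕ = ∧-conicalˡ _ _ I-ideal

    n∈ℕ : n ∈ℕ I ≡ true
    n∈ℕ = trans (∈ℕ-cong I n 0 (n%n≡0 n)) 0∈ℕ

    +-closedℕ : ∀ x y → x ∈ℕ I ≡ true → y ∈ℕ I ≡ true → (x + y) ∈ℕ I ≡ true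
    +-closedℕ x y x∈ y∈ = trans (∈ℕ-cong I (x + y) (toℕ (x mod n) + toℕ (y mod n)) residue) (+-closed (x mod n) (y mod n) x∈ y∈)
      where
      residue : (x + y) % n ≡ (toℕ (x mod n) + toℕ (y mod n)) % n
      residue = trans (%-distribˡ-+ x y n) (sym (cong₂ (λ u v → (u + v) % n) (toℕ-mod x) (toℕ-mod y)))

    *-closedℕ : ∀ r x → x ∈ℕ I ≡ true → (r * x) ∈ℕ I ≡ true
    *-closedℕ r x x∈ = trans (∈ℕ-cong I (r * x) (toℕ (r mod n) * toℕ (x mod n)) residue) (*-closed (r mod n) (x mod n) x∈)
      where
      residue : (r * x) % n ≡ (toℕ (r mod n) * toℕ (x mod n)) % n
      residue = trans (%-distribˡ-* r x n) (sym (cong₂ (λ u v → (u * v) % n) (toℕ-mod r) (toℕ-mod x)))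

    -- x ∸ y ≡ x + k * y modulo n = k + 1, so closure under + and * suffices
    ∸-closedℕ : ∀ x y → y ≤ x → x ∈ℕ I ≡ true → y ∈ℕ I ≡ true → (x ∸ y) ∈ℕ I ≡ true
    ∸-closedℕ x y y≤x x∈ y∈ = trans (∈ℕ-cong I (x ∸ y) (x + k * y) residue) (+-closedℕ x (k * y) x∈ (*-closedℕ k y y∈))
      where
      residue : (x ∸ y) % n ≡ (x + k * y) % n
      residue = begin
        (x ∸ y) % n             ≡⟨ %-remove-+ʳ (x ∸ y) (m∣m*n y) ⟨
        (x ∸ y + n * y) % n     ≡⟨ cong (_% n) (+-assoc (x ∸ y) y (k * y)) ⟨
        (x ∸ y + y + k * y) % n ≡⟨ cong (λ z → (z + k * y) % n) (m∸n+n≡m y≤x) ⟩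
        (x + k * y) % n         ∎
        where open ≡-Reasoning

    -- the generator is the least positive element
    private
      least : ∃ λ d → d ≤ k × suc d ∈ℕ I ≡ true × (∀ e → e < d → suc e ∈ℕ I ≡ false)
      least with least-true-≤ (λ e → suc e ∈ℕ I) k
      ... | inj₁ found = found
      ... | inj₂ none with () ← trans (sym n∈ℕ) (none k ≤-refl)

    generator : ℕ
    generator = suc (proj₁ least)

    generator∈ℕ : generator ∈ℕ I ≡ true
    generator∈ℕ = proj₁ (proj₂ (proj₂ least))

    generator-least : ∀ e → suc e < generator → suc e ∈ℕ I ≡ false
    generator-least e (s≤s e<d) = proj₂ (proj₂ (proj₂ least)) e e<d

    ∈ℕ⇒generator∣ : ∀ x → x ∈ℕ I ≡ true → generator ∣ x
    ∈ℕ⇒generator∣ x x∈ = m%n≡0⇒n∣m x generator remainder≡0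
      where
      g : ℕ
      g = generator
      remainder∈ : (x % g) ∈ℕ I ≡ true
      remainder∈ = subst (λ z → z ∈ℕ I ≡ true) (sym (m%n≡m∸m/n*n x g))
        (∸-closedℕ x (x / g * g) (m/n*n≤m x g) x∈ (*-closedℕ (x / g) g generator∈ℕ))
      remainder≡0 : x % g ≡ 0
      remainder≡0 with x % g in eq
      ... | zero = refl
      ... | suc r with () ← trans (sym (subst (λ z → z ∈ℕ I ≡ true) eq remainder∈))
                                  (generator-least r (subst (_< g) eq (m%n<n x g)))

    generator∣⇒∈ℕ : ∀ x → generator ∣ x → x ∈ℕ I ≡ true
    generator∣⇒∈ℕ x (divides c refl) = *-closedℕ c generator generator∈ℕ

    generator∣n : generator ∣ n
    generator∣n = ∈ℕ⇒generator∣ n n∈ℕ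

    ≡multiples : I ≡ multiples generator
    ≡multiples = subset-ext λ a → true⇔true⇒≡
      (λ a∈ → ∈-multiples⁺ a (∈ℕ⇒generator∣ (toℕ a) (trans (sym (∈ℕ-toℕ I a)) a∈)))
      (λ a∈ → trans (∈ℕ-toℕ I a) (generator∣⇒∈ℕ (toℕ a) (∈-multiples⁻ a a∈)))

  ideal⇒multiples : ∀ {I} → isIdeal I ≡ true → ∃ λ g → g ∣ n × I ≡ multiples g
  ideal⇒multiples {I} I-ideal = generator , generator∣n , ≡multiples
    where open Ideal I I-ideal

  0∈multiples : ∀ g → Fin.zero ∈ᵇ multiples g ≡ true
  0∈multiples g = ∈-multiples⁺ Fin.zero (g ∣0)

  multiples-ideal : ∀ {g} → g ∣ n → isIdeal (multiples g) ≡ true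
  multiples-ideal {g} g∣n = cong₂ _∧_ (0∈multiples g) (cong₂ _∧_ +-holds (cong₂ _∧_ neg-holds *-holds))
    where
    ∣-residue : ∀ x → g ∣ x → g ∣ toℕ (x mod n)
    ∣-residue x g∣x = subst (g ∣_) (sym (toℕ-mod x)) (∣-% x g∣n g∣x)
    +-holds : allZ (λ a → allZ (λ b → (a ∈ᵇ multiples g ∧ b ∈ᵇ multiples g) ⇒ᵇ ((a +ᶻ b) ∈ᵇ multiples g))) ≡ true
    +-holds = allZ⁺ _ λ a → allZ⁺ _ λ b → ⇒ᵇ-intro λ both →
      ∈-multiples⁺ (a +ᶻ b) (∣-residue _ (∣m∣n⇒∣m+n (∈-multiples⁻ a (∧-conicalˡ _ _ both))
                                                      (∈-multiples⁻ b (∧-conicalʳ (a ∈ᵇ multiples g) _ both))))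
    neg-holds : allZ (λ a → a ∈ᵇ multiples g ⇒ᵇ ((-ᶻ a) ∈ᵇ multiples g)) ≡ true
    neg-holds = allZ⁺ _ λ a → ⇒ᵇ-intro λ a∈ →
      ∈-multiples⁺ (-ᶻ a) (∣-residue _ (∣m+n∣m⇒∣n (subst (g ∣_) (sym (m+[n∸m]≡n (<⇒≤ (toℕ<n a)))) g∣n)
                                                   (∈-multiples⁻ a a∈)))
    *-holds : allZ (λ r → allZ (λ a → a ∈ᵇ multiples g ⇒ᵇ ((r *ᶻ a) ∈ᵇ multiples g))) ≡ true
    *-holds = allZ⁺ _ λ r → allZ⁺ _ λ a → ⇒ᵇ-intro λ a∈ →
      ∈-multiples⁺ (r *ᶻ a) (∣-residue _ (∣n⇒∣m*n (toℕ r) (∈-multiples⁻ a a∈)))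

  private
    splits : Subset n → Subset n → Fin n → Fin n → Fin n → Bool
    splits I K c a b = a ∈ᵇ I ∧ b ∈ᵇ K ∧ ((a +ᶻ b) == c)

  ∈-⊕⁺ : ∀ {I K : Subset n} a b c → a ∈ᵇ I ≡ true → b ∈ᵇ K ≡ true → toℕ c ≡ (toℕ a + toℕ b) % n →
    c ∈ᵇ (I ⊕ K) ≡ true
  ∈-⊕⁺ {I} {K} a b c a∈ b∈ c≡ =
    trans (lookup∘tabulate (λ c → anyZ (λ a → anyZ (splits I K c a))) c)
      (anyZ⁺ (λ a → anyZ (splits I K c a)) a (anyZ⁺ (splits I K c a) b
        (cong₂ _∧_ a∈ (cong₂ _∧_ b∈ (Equivalence.to T-≡ (≡⇒≡ᵇ _ _ (trans (toℕ-mod (toℕ a + toℕ b)) (sym c≡))))))))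

  ∈-⊕ˡ : ∀ {I K : Subset n} a → a ∈ᵇ I ≡ true → Fin.zero ∈ᵇ K ≡ true → a ∈ᵇ (I ⊕ K) ≡ true
  ∈-⊕ˡ {I} {K} a a∈ 0∈ = ∈-⊕⁺ {I} {K} a Fin.zero a a∈ 0∈
    (sym (trans (cong (_% n) (+-identityʳ (toℕ a))) (m<n⇒m%n≡m (toℕ<n a))))

  ∈-⊕ʳ : ∀ {I K : Subset n} b → Fin.zero ∈ᵇ I ≡ true → b ∈ᵇ K ≡ true → b ∈ᵇ (I ⊕ K) ≡ true
  ∈-⊕ʳ {I} {K} b 0∈ b∈ = ∈-⊕⁺ {I} {K} Fin.zero b b 0∈ b∈ (sym (m<n⇒m%n≡m (toℕ<n b)))

  ∈-⊕⁻ : ∀ {I K : Subset n} c → c ∈ᵇ (I ⊕ K) ≡ true →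
    ∃ λ a → ∃ λ b → a ∈ᵇ I ≡ true × b ∈ᵇ K ≡ true × toℕ c ≡ (toℕ a + toℕ b) % n
  ∈-⊕⁻ {I} {K} c c∈ =
    let a , splits-a = anyZ⁻ (λ a → anyZ (splits I K c a))
                         (trans (sym (lookup∘tabulate (λ c → anyZ (λ a → anyZ (splits I K c a))) c)) c∈)
        b , ab∈ = anyZ⁻ (splits I K c a) splits-a
        b∈∧sum = ∧-conicalʳ (a ∈ᵇ I) _ ab∈
        sum≡c = ≡ᵇ⇒≡ _ _ (Equivalence.from T-≡ (∧-conicalʳ (b ∈ᵇ K) _ b∈∧sum))
    in a , b , ∧-conicalˡ _ _ ab∈ , ∧-conicalˡ _ _ b∈∧sum , trans (sym sum≡c) (toℕ-mod (toℕ a + toℕ b))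

  ∣-multiples-⊕ : ∀ {d g h} c → d ∣ g → d ∣ h → d ∣ n → c ∈ᵇ (multiples g ⊕ multiples h) ≡ true → d ∣ toℕ c
  ∣-multiples-⊕ {d} {g} {h} c d∣g d∣h d∣n c∈ =
    let a , b , a∈ , b∈ , c≡ = ∈-⊕⁻ {multiples g} {multiples h} c c∈ in
    subst (d ∣_) (sym c≡) (∣-% _ d∣n (∣m∣n⇒∣m+n (∣-trans d∣g (∈-multiples⁻ a a∈)) (∣-trans d∣h (∈-multiples⁻ b b∈))))

  n∣∧<n⇒≡0 : ∀ {x} → n ∣ x → x < n → x ≡ 0
  n∣∧<n⇒≡0 {x} n∣x x<n = trans (sym (m<n⇒m%n≡m x<n)) (n∣m⇒m%n≡0 x n n∣x)

  fromℕ<-∈-multiples : ∀ {g} (g<n : g < n) → fromℕ< g<n ∈ᵇ multiples g ≡ true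
  fromℕ<-∈-multiples {g} g<n = ∈-multiples⁺ (fromℕ< g<n) (subst (g ∣_) (sym (toℕ-fromℕ< g<n)) ∣-refl)

  multiples-nonzero : ∀ {g} → g ∣ n → g < n → isNonzero (multiples g) ≡ true
  multiples-nonzero {g} g∣n g<n = nonzero⁺ {I = multiples g} (fromℕ< g<n) (fromℕ<-∈-multiples g<n)
    λ g≡0 → 0∤n (subst (_∣ n) (trans (sym (toℕ-fromℕ< g<n)) g≡0) g∣n)
    where
    0∤n : ¬ 0 ∣ n
    0∤n 0∣n with () ← 0∣⇒≡0 0∣n

  multiples-n-zero : isNonzero (multiples n) ≡ false
  multiples-n-zero = nonzero-false {I = multiples n} λ a a∈ → n∣∧<n⇒≡0 (∈-multiples⁻ a a∈) (toℕ<n a)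

  multiples-proper : ∀ {g} → 1 < n → g ≢ 1 → isProper (multiples g) ≡ true
  multiples-proper {g} 1<n g≢1 = anyZ⁺ (λ a → not (a ∈ᵇ multiples g)) (fromℕ< 1<n)
    (cong not (∉-multiples (fromℕ< 1<n) λ g∣1 → g≢1 (∣1⇒≡1 (subst (g ∣_) (toℕ-fromℕ< 1<n) g∣1))))

  multiples-1-improper : isProper (multiples 1) ≡ false
  multiples-1-improper = anyZ-false (λ a → not (a ∈ᵇ multiples 1)) λ a → cong not (∈-multiples⁺ a (1∣ _))

  -- g is recovered from multiples g as the residue g (or, when g = n, as n itself)
  multiples-≡⇒∣ : ∀ {g h} → g ∣ n → h ∣ n → multiples g ≡ multiples h → h ∣ g
  multiples-≡⇒∣ {g} {h} g∣n h∣n eq with m≤n⇒m<n∨m≡n (∣⇒≤ g∣n)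
  ... | inj₂ refl = h∣n
  ... | inj₁ g<n = subst (h ∣_) (toℕ-fromℕ< g<n)
        (∈-multiples⁻ (fromℕ< g<n) (subst (λ I → fromℕ< g<n ∈ᵇ I ≡ true) eq (fromℕ<-∈-multiples g<n)))

  multiples-injective : ∀ {g h} → g ∣ n → h ∣ n → multiples g ≡ multiples h → g ≡ h
  multiples-injective g∣n h∣n eq = ∣-antisym (multiples-≡⇒∣ h∣n g∣n (sym eq)) (multiples-≡⇒∣ g∣n h∣n eq)

-- Graph distance

module _ {n : ℕ} where

  walk₁ : ∀ {u v : Subset n} → u ∈ vertices n → adj u v ≡ true → walkWithin n 1 u v ≡ true
  walk₁ {u} {v} u∈ u~v = trans (cong (eqSubset u v ∨_)
    (anyL⁺ (λ w → eqSubset u w ∧ adj w v) u∈ (cong₂ _∧_ (eqSubset-refl u) u~v))) (∨-zeroʳ (eqSubset u v))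

  walk₁-false : ∀ {u v : Subset n} → u ≢ v → adj u v ≡ false → walkWithin n 1 u v ≡ false
  walk₁-false {u} {v} u≢v u≁v = cong₂ _∨_ (eqSubset-≢ {I = u} {v} u≢v) (anyL-false (λ w → eqSubset u w ∧ adj w v) (vertices n) no-step)
    where
    no-step : ∀ {w} → w ∈ vertices n → eqSubset u w ∧ adj w v ≡ false
    no-step {w} _ with eqSubset u w in eq
    ... | false = refl
    ... | true = subst (λ x → adj x v ≡ false) (eqSubset⇒≡ {I = u} {w} eq) u≁v

  walk₂ : ∀ {u v w : Subset n} → w ∈ vertices n → walkWithin n 1 u w ≡ true → adj w v ≡ true → walkWithin n 2 u v ≡ true
  walk₂ {u} {v} w∈ u-w w~v = trans (cong (walkWithin n 1 u v ∨_)
    (anyL⁺ (λ w → walkWithin n 1 u w ∧ adj w v) w∈ (cong₂ _∧_ u-w w~v))) (∨-zeroʳ (walkWithin n 1 u v))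

  -- dist only searches up to the number of vertices, so two vertices are needed to reach distance 2
  dist≡1 : ∀ {u v : Subset n} → 2 ≤ length (vertices n) → u ≢ v → walkWithin n 1 u v ≡ true → dist n u v ≡ 1
  dist≡1 {u} {v} 2≤|V| u≢v walk with length (vertices n) | 2≤|V|
  ... | suc zero | s≤s ()
  ... | suc (suc f) | _ rewrite eqSubset-≢ u≢v | walk = refl

  dist≡2 : ∀ {u v : Subset n} → 2 ≤ length (vertices n) → u ≢ v →
    walkWithin n 1 u v ≡ false → walkWithin n 2 u v ≡ true → dist n u v ≡ 2
  dist≡2 {u} {v} 2≤|V| u≢v no-walk walk with length (vertices n) | 2≤|V|
  ... | suc zero | s≤s ()
  ... | suc (suc zero) | _ rewrite eqSubset-≢ u≢v | no-walk = refl
  ... | suc (suc (suc f)) | _ rewrite eqSubset-≢ u≢v | no-walk | walk = refl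

  dist-adjacent : ∀ {u v : Subset n} → 2 ≤ length (vertices n) → u ∈ vertices n → u ≢ v → adj u v ≡ true → dist n u v ≡ 1
  dist-adjacent {u} {v} 2≤|V| u∈ u≢v u~v = dist≡1 {u} {v} 2≤|V| u≢v (walk₁ {u} {v} u∈ u~v)

  dist-common-neighbour : ∀ {u v w : Subset n} → 2 ≤ length (vertices n) → u ∈ vertices n → w ∈ vertices n → u ≢ v →
    adj u v ≡ false → adj u w ≡ true → adj w v ≡ true → dist n u v ≡ 2
  dist-common-neighbour {u} {v} {w} 2≤|V| u∈ w∈ u≢v u≁v u~w w~v =
    dist≡2 {u} {v} 2≤|V| u≢v (walk₁-false {u} {v} u≢v u≁v) (walk₂ {u} {v} {w} w∈ (walk₁ {u} {w} u∈ u~w) w~v)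

choose2 : ℕ → ℕ
choose2 zero = 0
choose2 (suc l) = l + choose2 l

module _ {A : Set} (d : A → A → ℕ) where

  crossSum : List A → List A → ℕ
  crossSum [] ys = 0
  crossSum (x ∷ xs) ys = sum (map (d x) ys) + crossSum xs ys

  pairSum-++ : ∀ xs ys → pairSum d (xs ++ ys) ≡ pairSum d xs + pairSum d ys + crossSum xs ys
  pairSum-++ [] ys = sym (+-identityʳ (pairSum d ys))
  pairSum-++ (x ∷ xs) ys
    rewrite map-++ (d x) xs ys | sum-++ (map (d x) xs) (map (d x) ys) | pairSum-++ xs ys
    = regroup (sum (map (d x) xs)) (sum (map (d x) ys)) (pairSum d xs) (pairSum d ys) (crossSum xs ys)
    where
    regroup : ∀ a b c e f → a + b + (c + e + f) ≡ a + c + e + (b + f)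
    regroup = solve-∀

  sum-map-const : ∀ c x ys → (∀ {y} → y ∈ ys → d x y ≡ c) → sum (map (d x) ys) ≡ c * length ys
  sum-map-const c x [] h = sym (*-zeroʳ c)
  sum-map-const c x (y ∷ ys) h
    rewrite h (here refl) | sum-map-const c x ys (λ m → h (there m)) = sym (*-suc c (length ys))

  crossSum-const : ∀ c xs ys → (∀ {x y} → x ∈ xs → y ∈ ys → d x y ≡ c) → crossSum xs ys ≡ c * (length xs * length ys)
  crossSum-const c [] ys h = sym (*-zeroʳ c)
  crossSum-const c (x ∷ xs) ys h
    rewrite sum-map-const c x ys (h (here refl)) | crossSum-const c xs ys (λ m → h (there m))
    = sym (*-distribˡ-+ c (length ys) (length xs * length ys))

  pairSum-const : ∀ c xs → Unique xs → (∀ {x y} → x ∈ xs → y ∈ xs → x ≢ y → d x y ≡ c) →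
    pairSum d xs ≡ c * choose2 (length xs)
  pairSum-const c [] _ h = sym (*-zeroʳ c)
  pairSum-const c (x ∷ xs) (x∉xs ∷ xs-unique) h
    rewrite sum-map-const c x xs (λ m → h (here refl) (there m) (All.lookup x∉xs m))
          | pairSum-const c xs xs-unique (λ m m′ → h (there m) (there m′))
    = sym (*-distribˡ-+ c (length xs) (choose2 (length xs)))

  pairSum-↭ : ∀ {xs ys} → (∀ {x y} → x ∈ xs → y ∈ xs → d x y ≡ d y x) → xs ↭ ys → pairSum d xs ≡ pairSum d ys
  pairSum-↭ sym-d ↭.refl = refl
  pairSum-↭ sym-d (↭.prep x p) = cong₂ _+_ (sum-↭ (Perm.map⁺ (d x) p)) (pairSum-↭ (λ m m′ → sym-d (there m) (there m′)) p)
  pairSum-↭ {x ∷ y ∷ xs} {.y ∷ .x ∷ ys} sym-d (↭.swap .x .y p)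
    rewrite sym-d (here refl) (there (here refl))
          | sum-↭ (Perm.map⁺ (d x) p) | sum-↭ (Perm.map⁺ (d y) p)
          | pairSum-↭ (λ m m′ → sym-d (there (there m)) (there (there m′))) p
    = regroup (d y x) (sum (map (d x) ys)) (sum (map (d y) ys)) (pairSum d ys)
    where
    regroup : ∀ a b c e → a + b + (c + e) ≡ a + c + (b + e)
    regroup = solve-∀
  pairSum-↭ sym-d (↭.trans p q) =
    trans (pairSum-↭ sym-d p) (pairSum-↭ (λ m m′ → sym-d (Perm.∈-resp-↭ (↭.↭-sym p) m) (Perm.∈-resp-↭ (↭.↭-sym p) m′)) q)

pairSum-map : ∀ {A B : Set} (d : B → B → ℕ) (f : A → B) xs → pairSum d (map f xs) ≡ pairSum (λ x y → d (f x) (f y)) xs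
pairSum-map d f [] = refl
pairSum-map d f (x ∷ xs) = cong₂ _+_ (cong sum (sym (map-∘ xs))) (pairSum-map d f xs)

length-cartesianProduct : ∀ {A B : Set} (xs : List A) (ys : List B) → length (cartesianProduct xs ys) ≡ length xs * length ys
length-cartesianProduct [] ys = refl
length-cartesianProduct (x ∷ xs) ys =
  trans (length-++ (map (x ,_) ys)) (cong₂ _+_ (length-map (x ,_) ys) (length-cartesianProduct xs ys))

choose2-+ : ∀ a b → choose2 (a + b) ≡ choose2 a + choose2 b + a * b
choose2-+ zero b = sym (+-identityʳ (choose2 b))
choose2-+ (suc a) b rewrite choose2-+ a b = regroup a b (choose2 a) (choose2 b)
  where
  regroup : ∀ a b x y → a + b + (x + y + a * b) ≡ a + x + y + (b + a * b)
  regroup = solve-∀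

twice-choose2 : ∀ l → 2 * choose2 l + l ≡ l * l
twice-choose2 zero = refl
twice-choose2 (suc l) = begin
  2 * (l + choose2 l) + suc l     ≡⟨ regroup l (choose2 l) ⟩
  2 * choose2 l + l + (2 * l + 1) ≡⟨ cong (_+ (2 * l + 1)) (twice-choose2 l) ⟩
  l * l + (2 * l + 1)             ≡⟨ square-suc l ⟩
  suc l * suc l                   ∎
  where
  open ≡-Reasoning
  regroup : ∀ l x → 2 * (l + x) + suc l ≡ 2 * x + l + (2 * l + 1)
  regroup = solve-∀
  square-suc : ∀ l → l * l + (2 * l + 1) ≡ suc l * suc l
  square-suc = solve-∀

Unique-map⁺ : ∀ {A B : Set} (f : A → B) {xs : List A} →
  (∀ {x y} → x ∈ xs → y ∈ xs → f x ≡ f y → x ≡ y) → Unique xs → Unique (map f xs)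
Unique-map⁺ f {[]} _ _ = []
Unique-map⁺ f {x ∷ xs} f-inj (x∉xs ∷ xs-unique) =
  All.tabulate (λ fy∈ fx≡fy → let y , y∈ , fy≡ = ∈-map⁻ f fy∈ in All.lookup x∉xs y∈ (f-inj (here refl) (there y∈) (trans fx≡fy fy≡)))
  ∷ Unique-map⁺ f (λ x∈ y∈ → f-inj (there x∈) (there y∈)) xs-unique

-- Divisors of p^a q^b

^-monoʳ-∣ : ∀ r {a m} → a ≤ m → r ^ a ∣ r ^ m
^-monoʳ-∣ r {zero} _ = 1∣ _
^-monoʳ-∣ r {suc a} {suc m} (s≤s a≤m) = *-monoʳ-∣ r (^-monoʳ-∣ r a≤m)

prime∤⇒coprime : ∀ {p g} → Prime p → ¬ p ∣ g → Coprime g p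
prime∤⇒coprime p-prime p∤g (d∣g , d∣p) with prime⇒irreducible p-prime d∣p
... | inj₁ d≡1 = d≡1
... | inj₂ refl = ⊥-elim (p∤g d∣g)

prime∤1 : ∀ {p} → Prime p → ¬ p ∣ 1
prime∤1 p-prime p∣1 = ¬prime[1] (subst Prime (∣1⇒≡1 p∣1) p-prime)

prime∤^ : ∀ {p q} → Prime p → Prime q → p ≢ q → ∀ b → ¬ p ∣ q ^ b
prime∤^ p-prime q-prime p≢q zero = prime∤1 p-prime
prime∤^ {p} {q} p-prime q-prime p≢q (suc b) p∣q^1+b with euclidsLemma q (q ^ b) p-prime p∣q^1+b
... | inj₂ p∣q^b = prime∤^ p-prime q-prime p≢q b p∣q^b
... | inj₁ p∣q with prime⇒irreducible q-prime p∣q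
...   | inj₁ p≡1 = ¬prime[1] (subst Prime p≡1 p-prime)
...   | inj₂ p≡q = p≢q p≡q

∣p^m*r⇒p^a*∣r : ∀ {p} → Prime p → ∀ m {r g} → g ∣ p ^ m * r →
  ∃₂ λ a g′ → a ≤ m × g′ ∣ r × g ≡ p ^ a * g′
∣p^m*r⇒p^a*∣r p-prime zero {r} {g} g∣r = 0 , g , z≤n , subst (g ∣_) (*-identityˡ r) g∣r , sym (*-identityˡ g)
∣p^m*r⇒p^a*∣r {p} p-prime (suc m) {r} {g} g∣p^1+m*r with p ∣? g
... | yes (divides c refl) =
  let instance _ = prime⇒nonZero p-prime
      a , g′ , a≤m , g′∣r , c≡ = ∣p^m*r⇒p^a*∣r p-prime m
        (*-cancelˡ-∣ p (subst₂ _∣_ (*-comm c p) (*-assoc p (p ^ m) r) g∣p^1+m*r))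
  in suc a , g′ , s≤s a≤m , g′∣r , trans (cong (_* p) c≡) (trans (*-comm (p ^ a * g′) p) (sym (*-assoc p (p ^ a) g′)))
... | no p∤g =
  let a , g′ , a≤m , g′∣r , g≡ = ∣p^m*r⇒p^a*∣r p-prime m
        (coprime-divisor (prime∤⇒coprime p-prime p∤g) (subst (g ∣_) (*-assoc p (p ^ m) r) g∣p^1+m*r))
  in a , g′ , m≤n⇒m≤1+n a≤m , g′∣r , g≡

^*-injective : ∀ {q} .{{_ : NonZero q}} → ∀ b d {x y} → ¬ q ∣ x → ¬ q ∣ y → q ^ b * x ≡ q ^ d * y → b ≡ d × x ≡ y
^*-injective zero zero {x} {y} _ _ e = refl , trans (sym (*-identityˡ x)) (trans e (*-identityˡ y))
^*-injective {q} zero (suc d) {x} {y} q∤x _ e =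
  ⊥-elim (q∤x (divides (q ^ d * y) (trans (sym (*-identityˡ x)) (trans e (trans (*-assoc q (q ^ d) y) (*-comm q (q ^ d * y)))))))
^*-injective {q} (suc b) zero {x} {y} _ q∤y e =
  ⊥-elim (q∤y (divides (q ^ b * x) (trans (sym (*-identityˡ y)) (trans (sym e) (trans (*-assoc q (q ^ b) x) (*-comm q (q ^ b * x)))))))
^*-injective {q} (suc b) (suc d) {x} {y} q∤x q∤y e =
  let b≡d , x≡y = ^*-injective b d q∤x q∤y
                    (*-cancelˡ-≡ (q ^ b * x) (q ^ d * y) q (trans (sym (*-assoc q (q ^ b) x)) (trans e (*-assoc q (q ^ d) y))))
  in cong suc b≡d , x≡y

module TwoPrimePowers {p q : ℕ} (p-prime : Prime p) (q-prime : Prime q) (p≢q : p ≢ q) where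

  D : ℕ → ℕ → ℕ
  D a b = p ^ a * q ^ b

  D-injective : ∀ {a b c d} → D a b ≡ D c d → a ≡ c × b ≡ d
  D-injective {a} {b} {c} {d} e =
    let instance
          _ = prime⇒nonZero p-prime
          _ = prime⇒nonZero q-prime
        a≡c , q^b≡q^d = ^*-injective a c (prime∤^ p-prime q-prime p≢q b) (prime∤^ p-prime q-prime p≢q d) e
        b≡d , _ = ^*-injective b d (prime∤1 q-prime) (prime∤1 q-prime) (trans (*-identityʳ (q ^ b)) (trans q^b≡q^d (sym (*-identityʳ (q ^ d)))))
    in a≡c , b≡d

  D≢0 : ∀ a b → D a b ≢ 0
  D≢0 a b = ≢-nonZero⁻¹ (D a b) {{m*n≢0 (p ^ a) (q ^ b) {{m^n≢0 p a}} {{m^n≢0 q b}}}}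
    where
    instance
      _ = prime⇒nonZero p-prime
      _ = prime⇒nonZero q-prime

  D-mono-∣ : ∀ {a b c d} → a ≤ c → b ≤ d → D a b ∣ D c d
  D-mono-∣ a≤c b≤d = *-pres-∣ (^-monoʳ-∣ p a≤c) (^-monoʳ-∣ q b≤d)

  ∣D⇒≡D : ∀ {m₁ m₂ g} → g ∣ D m₁ m₂ → ∃₂ λ a b → a ≤ m₁ × b ≤ m₂ × g ≡ D a b
  ∣D⇒≡D {m₁} {m₂} {g} g∣D =
    let a , g′ , a≤m₁ , g′∣q^m₂ , g≡ = ∣p^m*r⇒p^a*∣r p-prime m₁ g∣D
        b , g″ , b≤m₂ , g″∣1 , g′≡ = ∣p^m*r⇒p^a*∣r q-prime m₂ (subst (g′ ∣_) (sym (*-identityʳ (q ^ m₂))) g′∣q^m₂)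
    in a , b , a≤m₁ , b≤m₂ ,
       trans g≡ (cong (p ^ a *_) (trans g′≡ (trans (cong (q ^ b *_) (∣1⇒≡1 g″∣1)) (*-identityʳ (q ^ b)))))

  coprime-^ : ∀ a b → Coprime (q ^ b) (p ^ a)
  coprime-^ a b {d} (d∣q^b , d∣p^a) with ∣p^m*r⇒p^a*∣r q-prime b (subst (d ∣_) (sym (*-identityʳ (q ^ b))) d∣q^b)
  ... | zero , g′ , _ , g′∣1 , d≡ = trans d≡ (trans (*-identityˡ g′) (∣1⇒≡1 g′∣1))
  ... | suc c , g′ , _ , _ , refl =
    ⊥-elim (prime∤^ q-prime p-prime (λ q≡p → p≢q (sym q≡p)) a (∣-trans (∣-trans (m∣m*n (q ^ c)) (m∣m*n g′)) d∣p^a))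

  ^∣∧^∣⇒D∣ : ∀ {a b x} → p ^ a ∣ x → q ^ b ∣ x → D a b ∣ x
  ^∣∧^∣⇒D∣ {a} {b} (divides c refl) q^b∣x with coprime-divisor (coprime-^ a b) (subst (q ^ b ∣_) (*-comm c (p ^ a)) q^b∣x)
  ... | divides c′ refl = divides c′ (reassoc c′ (q ^ b) (p ^ a))
    where
    reassoc : ∀ x y z → x * y * z ≡ x * (z * y)
    reassoc = solve-∀

twice-choose2-ℤ : ∀ l → + 2 *ℤ + choose2 l ≡ + l *ℤ + l -ℤ + l
twice-choose2-ℤ l = begin
  + 2 *ℤ + choose2 l                ≡⟨ pos-* 2 (choose2 l) ⟨
  + (2 * choose2 l)                 ≡⟨ cancel-+ (+ (2 * choose2 l)) (+ l) ⟩
  + (2 * choose2 l) +ℤ + l -ℤ + l   ≡⟨ cong (_-ℤ + l) (pos-+ (2 * choose2 l) l) ⟨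
  + (2 * choose2 l + l) -ℤ + l      ≡⟨ cong (λ x → + x -ℤ + l) (twice-choose2 l) ⟩
  + (l * l) -ℤ + l                  ≡⟨ cong (_-ℤ + l) (pos-* l l) ⟩
  + l *ℤ + l -ℤ + l                 ∎
  where
  open ≡-Reasoning
  cancel-+ : ∀ x y → x ≡ x +ℤ y -ℤ y
  cancel-+ = IntegerSolver.solve-∀

wiener-arith : ∀ m₁ m₂ r → suc r ≡ m₁ * m₂ →
  + 2 *ℤ + (choose2 (m₂ + (m₁ + r)) + choose2 m₂ + choose2 m₁)
    ≡ (+ m₁ *ℤ + m₂) *ℤ (+ m₁ *ℤ + m₂ -ℤ + 1)
      +ℤ (+ m₁ +ℤ + m₂) *ℤ (+ 2 *ℤ + m₁ *ℤ + m₂ -ℤ + 4)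
      +ℤ + 2 *ℤ (+ 1 +ℤ + m₁ *ℤ + m₁ +ℤ + m₂ *ℤ + m₂)
wiener-arith m₁ m₂ r 1+r≡m₁m₂ = begin
  + 2 *ℤ + (choose2 N + choose2 m₂ + choose2 m₁)
    ≡⟨ cong (+ 2 *ℤ_) (trans (pos-+ (choose2 N + choose2 m₂) (choose2 m₁)) (cong (_+ℤ + choose2 m₁) (pos-+ (choose2 N) (choose2 m₂)))) ⟩
  + 2 *ℤ (+ choose2 N +ℤ + choose2 m₂ +ℤ + choose2 m₁)
    ≡⟨ distrib (+ choose2 N) (+ choose2 m₂) (+ choose2 m₁) ⟩
  + 2 *ℤ + choose2 N +ℤ + 2 *ℤ + choose2 m₂ +ℤ + 2 *ℤ + choose2 m₁
    ≡⟨ cong₂ _+ℤ_ (cong₂ _+ℤ_ (twice-choose2-ℤ N) (twice-choose2-ℤ m₂)) (twice-choose2-ℤ m₁) ⟩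
  + N *ℤ + N -ℤ + N +ℤ (+ m₂ *ℤ + m₂ -ℤ + m₂) +ℤ (+ m₁ *ℤ + m₁ -ℤ + m₁)
    ≡⟨ cong (λ x → x *ℤ x -ℤ x +ℤ (+ m₂ *ℤ + m₂ -ℤ + m₂) +ℤ (+ m₁ *ℤ + m₁ -ℤ + m₁)) +N≡ ⟩
  (+ m₂ +ℤ (+ m₁ +ℤ (+ m₁ *ℤ + m₂ -ℤ + 1))) *ℤ (+ m₂ +ℤ (+ m₁ +ℤ (+ m₁ *ℤ + m₂ -ℤ + 1)))
    -ℤ (+ m₂ +ℤ (+ m₁ +ℤ (+ m₁ *ℤ + m₂ -ℤ + 1))) +ℤ (+ m₂ *ℤ + m₂ -ℤ + m₂) +ℤ (+ m₁ *ℤ + m₁ -ℤ + m₁)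
    ≡⟨ expand (+ m₁) (+ m₂) ⟩
  (+ m₁ *ℤ + m₂) *ℤ (+ m₁ *ℤ + m₂ -ℤ + 1)
    +ℤ (+ m₁ +ℤ + m₂) *ℤ (+ 2 *ℤ + m₁ *ℤ + m₂ -ℤ + 4)
    +ℤ + 2 *ℤ (+ 1 +ℤ + m₁ *ℤ + m₁ +ℤ + m₂ *ℤ + m₂) ∎
  where
  open ≡-Reasoning
  N : ℕ
  N = m₂ + (m₁ + r)
  +r≡ : + r ≡ + m₁ *ℤ + m₂ -ℤ + 1
  +r≡ = begin
    + r                  ≡⟨ cancel-+ (+ r) ⟩
    + r +ℤ + 1 -ℤ + 1    ≡⟨ cong (_-ℤ + 1) (pos-+ r 1) ⟨
    + (r + 1) -ℤ + 1     ≡⟨ cong (λ x → + x -ℤ + 1) (trans (+-comm r 1) 1+r≡m₁m₂) ⟩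
    + (m₁ * m₂) -ℤ + 1   ≡⟨ cong (_-ℤ + 1) (pos-* m₁ m₂) ⟩
    + m₁ *ℤ + m₂ -ℤ + 1  ∎
    where
    cancel-+ : ∀ x → x ≡ x +ℤ + 1 -ℤ + 1
    cancel-+ = IntegerSolver.solve-∀
  +N≡ : + N ≡ + m₂ +ℤ (+ m₁ +ℤ (+ m₁ *ℤ + m₂ -ℤ + 1))
  +N≡ = trans (pos-+ m₂ (m₁ + r)) (cong (+ m₂ +ℤ_) (trans (pos-+ m₁ r) (cong (+ m₁ +ℤ_) +r≡)))
  distrib : ∀ x y z → + 2 *ℤ (x +ℤ y +ℤ z) ≡ + 2 *ℤ x +ℤ + 2 *ℤ y +ℤ + 2 *ℤ z
  distrib = IntegerSolver.solve-∀
  expand : ∀ M₁ M₂ →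
    (M₂ +ℤ (M₁ +ℤ (M₁ *ℤ M₂ -ℤ + 1))) *ℤ (M₂ +ℤ (M₁ +ℤ (M₁ *ℤ M₂ -ℤ + 1)))
      -ℤ (M₂ +ℤ (M₁ +ℤ (M₁ *ℤ M₂ -ℤ + 1))) +ℤ (M₂ *ℤ M₂ -ℤ M₂) +ℤ (M₁ *ℤ M₁ -ℤ M₁)
    ≡ (M₁ *ℤ M₂) *ℤ (M₁ *ℤ M₂ -ℤ + 1) +ℤ (M₁ +ℤ M₂) *ℤ (+ 2 *ℤ M₁ *ℤ M₂ -ℤ + 4) +ℤ + 2 *ℤ (+ 1 +ℤ M₁ *ℤ M₁ +ℤ M₂ *ℤ M₂)
  expand = IntegerSolver.solve-∀

-- The essential ideal graph of ℤ_(p^m₁ q^m₂)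

module EssentialIdealGraph {p q : ℕ} (p-prime : Prime p) (q-prime : Prime q) (p≢q : p ≢ q)
                           (s t k : ℕ) (n≡ : p ^ suc s * q ^ suc t ≡ suc k) where

  open TwoPrimePowers p-prime q-prime p≢q
  open Residues k

  m₁ m₂ : ℕ
  m₁ = suc s
  m₂ = suc t

  V : List (Subset n)
  V = vertices n

  Coord : Set
  Coord = ℕ × ℕ

  ideal : Coord → Subset n
  ideal (a , b) = multiples (D a b)

  InBox : Coord → Set
  InBox (a , b) = a ≤ m₁ × b ≤ m₂

  IsVertex : Coord → Set
  IsVertex c = InBox c × c ≢ (0 , 0) × c ≢ (m₁ , m₂)

  D∣n : ∀ {a b} → a ≤ m₁ → b ≤ m₂ → D a b ∣ n
  D∣n {a} {b} a≤m₁ b≤m₂ = subst (D a b ∣_) n≡ (D-mono-∣ a≤m₁ b≤m₂)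

  D<n : ∀ {a b} → InBox (a , b) → (a , b) ≢ (m₁ , m₂) → D a b < n
  D<n (a≤m₁ , b≤m₂) ≢top = ≤∧≢⇒< (∣⇒≤ (D∣n a≤m₁ b≤m₂)) λ D≡n → ≢top (×-≡,≡→≡ (D-injective (trans D≡n (sym n≡))))

  ideal-injective : ∀ {c c′} → InBox c → InBox c′ → ideal c ≡ ideal c′ → c ≡ c′
  ideal-injective (a≤ , b≤) (c≤ , d≤) eq = ×-≡,≡→≡ (D-injective (multiples-injective (D∣n a≤ b≤) (D∣n c≤ d≤) eq))

  ideal-≢ : ∀ {c c′} → InBox c → InBox c′ → c ≢ c′ → ideal c ≢ ideal c′
  ideal-≢ c∈ c′∈ c≢c′ eq = c≢c′ (ideal-injective c∈ c′∈ eq)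

  ideal∈V : ∀ {c} → IsVertex c → ideal c ∈ V
  ideal∈V {a , b} (box@(a≤ , b≤) , ≢bottom , ≢top) =
    ∈-vertices⁺ (multiples-ideal (D∣n a≤ b≤)) (multiples-nonzero (D∣n a≤ b≤) (D<n box ≢top))
      (multiples-proper 1<n λ D≡1 → ≢bottom (×-≡,≡→≡ (D-injective {a} {b} {0} {0} D≡1)))
    where
    1<n : 1 < n
    1<n = D<n {0} {0} (z≤n , z≤n) λ ()

  ideal-top-zero : isNonzero (ideal (m₁ , m₂)) ≡ false
  ideal-top-zero = trans (cong (λ g → isNonzero (multiples g)) n≡) multiples-n-zero

  ideal-coords : ∀ {I} → I ∈ ideals n → ∃ λ c → InBox c × I ≡ ideal c
  ideal-coords {I} I∈ with ideal⇒multiples {I} (∈-ideals⁻ I∈)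
  ... | g , g∣n , refl with ∣D⇒≡D {m₁} {m₂} (subst (g ∣_) (sym n≡) g∣n)
  ...   | a , b , a≤ , b≤ , refl = (a , b) , (a≤ , b≤) , refl

  V⇒ideal : ∀ {u} → u ∈ V → ∃ λ c → IsVertex c × u ≡ ideal c
  V⇒ideal {u} u∈ with ∈-vertices⁻ u∈
  ... | u-ideal , u≠0 , u-proper with ideal-coords {u} (∈-ideals⁺ u-ideal)
  ...   | c , box , refl = c , (box , ≢bottom , ≢top) , refl
    where
    ≢bottom : c ≢ (0 , 0)
    ≢bottom refl with () ← trans (sym u-proper) multiples-1-improper
    ≢top : c ≢ (m₁ , m₂)
    ≢top refl with () ← trans (sym u≠0) ideal-top-zero

  pFull qFull interior coords : List Coord
  pFull = map (m₁ ,_) (upTo m₂)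
  qFull = map (_, m₂) (upTo m₁)
  interior = drop 1 (cartesianProduct (upTo m₁) (upTo m₂))   -- drops (0 , 0)
  coords = pFull ++ qFull ++ interior

  r : ℕ
  r = pred (m₁ * m₂)

  length-pFull : length pFull ≡ m₂
  length-pFull = trans (length-map {B = Coord} (m₁ ,_) (upTo m₂)) (length-upTo m₂)

  length-qFull : length qFull ≡ m₁
  length-qFull = trans (length-map {B = Coord} (_, m₂) (upTo m₁)) (length-upTo m₁)

  length-interior : length interior ≡ r
  length-interior = cong pred (trans (length-cartesianProduct (upTo m₁) (upTo m₂))
                                     (cong₂ _*_ (length-upTo m₁) (length-upTo m₂)))

  length-coords : length coords ≡ m₂ + (m₁ + r)
  length-coords = trans (length-++ pFull) (cong₂ _+_ length-pFull
                    (trans (length-++ qFull) (cong₂ _+_ length-qFull length-interior)))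

  private
    grid-unique : Unique (cartesianProduct (upTo m₁) (upTo m₂))
    grid-unique = Unique.cartesianProduct⁺ (Unique.upTo⁺ m₁) (Unique.upTo⁺ m₂)

  ∈pFull⁻ : ∀ {c} → c ∈ pFull → proj₁ c ≡ m₁ × proj₂ c < m₂
  ∈pFull⁻ c∈ with ∈-map⁻ (m₁ ,_) c∈
  ... | _ , b∈ , refl = refl , ∈-upTo⁻ b∈

  ∈qFull⁻ : ∀ {c} → c ∈ qFull → proj₁ c < m₁ × proj₂ c ≡ m₂
  ∈qFull⁻ c∈ with ∈-map⁻ (_, m₂) c∈
  ... | _ , a∈ , refl = ∈-upTo⁻ a∈ , refl

  ∈interior⁻ : ∀ {c} → c ∈ interior → proj₁ c < m₁ × proj₂ c < m₂ × c ≢ (0 , 0)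
  ∈interior⁻ {c} c∈ with ∈-cartesianProduct⁻ (upTo m₁) (upTo m₂) {c} (there c∈) | grid-unique
  ... | a∈ , b∈ | origin∉interior ∷ _ = ∈-upTo⁻ a∈ , ∈-upTo⁻ b∈ , λ c≡ → All.lookup origin∉interior c∈ (sym c≡)

  ∈coords⁺ : ∀ {c} → IsVertex c → c ∈ coords
  ∈coords⁺ {a , b} ((a≤ , b≤) , ≢bottom , ≢top) with m≤n⇒m<n∨m≡n a≤ | m≤n⇒m<n∨m≡n b≤
  ... | inj₂ refl | inj₁ b< = ∈-++⁺ˡ (∈-map⁺ (m₁ ,_) (∈-upTo⁺ b<))
  ... | inj₂ refl | inj₂ refl = ⊥-elim (≢top refl)
  ... | inj₁ a< | inj₂ refl = ∈-++⁺ʳ pFull (∈-++⁺ˡ (∈-map⁺ (_, m₂) (∈-upTo⁺ a<)))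
  ... | inj₁ a< | inj₁ b< with ∈-cartesianProduct⁺ (∈-upTo⁺ {m₁} a<) (∈-upTo⁺ {m₂} b<)
  ...   | here refl = ⊥-elim (≢bottom refl)
  ...   | there c∈ = ∈-++⁺ʳ pFull (∈-++⁺ʳ qFull c∈)

  ∈coords⁻ : ∀ {c} → c ∈ coords → IsVertex c
  ∈coords⁻ c∈ with ∈-++⁻ pFull c∈
  ... | inj₁ c∈pFull = let a≡ , b< = ∈pFull⁻ c∈pFull in
        (≤-reflexive a≡ , <⇒≤ b<) , (λ { refl → 0≢1+n a≡ }) , λ { refl → <⇒≢ b< refl }
  ... | inj₂ c∈′ with ∈-++⁻ qFull c∈′
  ...   | inj₁ c∈qFull = let a< , b≡ = ∈qFull⁻ c∈qFull in
          (<⇒≤ a< , ≤-reflexive b≡) , (λ { refl → 0≢1+n b≡ }) , λ { refl → <⇒≢ a< refl }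
  ...   | inj₂ c∈interior = let a< , b< , ≢bottom = ∈interior⁻ c∈interior in
          (<⇒≤ a< , <⇒≤ b<) , ≢bottom , λ { refl → <⇒≢ a< refl }

  coords-unique : Unique coords
  coords-unique = Unique.++⁺ (Unique.map⁺ (cong proj₂) (Unique.upTo⁺ m₂))
    (Unique.++⁺ (Unique.map⁺ (cong proj₁) (Unique.upTo⁺ m₁)) (Unique.drop⁺ 1 grid-unique)
      λ (c∈qFull , c∈interior) → <⇒≢ (proj₁ (proj₂ (∈interior⁻ c∈interior))) (proj₂ (∈qFull⁻ c∈qFull)))
    λ (c∈pFull , c∈rest) → [ (λ c∈qFull → <⇒≢ (proj₁ (∈qFull⁻ c∈qFull)) (proj₁ (∈pFull⁻ c∈pFull)))
                            , (λ c∈interior → <⇒≢ (proj₁ (∈interior⁻ c∈interior)) (proj₁ (∈pFull⁻ c∈pFull))) ]′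
                            (∈-++⁻ qFull c∈rest)

  V↭ideals : V ↭ map ideal coords
  V↭ideals = ∼bag⇒↭ (unique∧set⇒bag V-unique
    (Unique-map⁺ ideal (λ c∈ c′∈ → ideal-injective (proj₁ (∈coords⁻ c∈)) (proj₁ (∈coords⁻ c′∈))) coords-unique)
    (mk⇔ V⇒mapped mapped⇒V))
    where
    V-unique : Unique V
    V-unique = Unique.filter⁺ _ (Unique.filter⁺ _ (allSubsets-unique n))
    V⇒mapped : ∀ {u} → u ∈ V → u ∈ map ideal coords
    V⇒mapped u∈ = let c , c-vertex , u≡ = V⇒ideal u∈ in subst (_∈ map ideal coords) (sym u≡) (∈-map⁺ ideal (∈coords⁺ c-vertex))
    mapped⇒V : ∀ {u} → u ∈ map ideal coords → u ∈ V
    mapped⇒V u∈ = let c , c∈ , u≡ = ∈-map⁻ ideal u∈ in subst (_∈ V) (sym u≡) (ideal∈V (∈coords⁻ c∈))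

  2≤|V| : 2 ≤ length V
  2≤|V| = subst (2 ≤_) (sym (trans (Perm.↭-length V↭ideals) (trans (length-map ideal coords) length-coords)))
                (+-mono-≤ (s≤s z≤n) (s≤s z≤n))

  Apart : Coord → Coord → Set
  Apart (a , b) (a′ , b′) = (a < m₁ ⊎ a′ < m₁) × (b < m₂ ⊎ b′ < m₂)

  Aligned : Coord → Coord → Set
  Aligned (a , b) (a′ , b′) = (a ≡ m₁ × a′ ≡ m₁) ⊎ (b ≡ m₂ × b′ ≡ m₂)

  apart-or-aligned : ∀ {c c′} → InBox c → InBox c′ → Apart c c′ ⊎ Aligned c c′
  apart-or-aligned (a≤ , b≤) (a′≤ , b′≤)
    with m≤n⇒m<n∨m≡n a≤ | m≤n⇒m<n∨m≡n a′≤ | m≤n⇒m<n∨m≡n b≤ | m≤n⇒m<n∨m≡n b′≤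
  ... | inj₂ a≡ | inj₂ a′≡ | _ | _ = inj₂ (inj₁ (a≡ , a′≡))
  ... | _ | _ | inj₂ b≡ | inj₂ b′≡ = inj₂ (inj₂ (b≡ , b′≡))
  ... | inj₁ a< | _ | inj₁ b< | _ = inj₁ (inj₁ a< , inj₁ b<)
  ... | inj₁ a< | _ | inj₂ _ | inj₁ b′< = inj₁ (inj₁ a< , inj₂ b′<)
  ... | inj₂ _ | inj₁ a′< | inj₁ b< | _ = inj₁ (inj₂ a′< , inj₁ b<)
  ... | inj₂ _ | inj₁ a′< | inj₂ _ | inj₁ b′< = inj₁ (inj₂ a′< , inj₂ b′<)

  Apart-sym : ∀ {c c′} → Apart c c′ → Apart c′ c
  Apart-sym (a , b) = Sum.swap a , Sum.swap b

  0∈ideal : ∀ c → Fin.zero ∈ᵇ ideal c ≡ true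
  0∈ideal (a , b) = 0∈multiples (D a b)

  residue∈ideal : ∀ {a b} a′ b′ (D<n : D a′ b′ < n) → a ≤ a′ → b ≤ b′ → fromℕ< D<n ∈ᵇ ideal (a , b) ≡ true
  residue∈ideal {a} {b} _ _ D<n a≤ b≤ = ∈-multiples⁺ (fromℕ< D<n) (subst (D a b ∣_) (sym (toℕ-fromℕ< D<n)) (D-mono-∣ a≤ b≤))

  residue≢0 : ∀ a b (D<n : D a b < n) → toℕ (fromℕ< D<n) ≢ 0
  residue≢0 a b D<n = D≢0 a b ∘′ trans (sym (toℕ-fromℕ< D<n))

  -- p ^ (m₁ - 1) q ^ m₂ lies in every ideal not contained in (p ^ m₁), and symmetrically for q
  private
    pWitness< : D s m₂ < n
    pWitness< = D<n (n≤1+n s , ≤-refl) λ eq → <⇒≢ (n<1+n s) (cong proj₁ eq)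

    qWitness< : D m₁ t < n
    qWitness< = D<n (≤-refl , n≤1+n t) λ eq → <⇒≢ (n<1+n t) (cong proj₂ eq)

  pWitness qWitness : Fin n
  pWitness = fromℕ< pWitness<
  qWitness = fromℕ< qWitness<

  pWitness∈ : ∀ {a b} → a < m₁ → b ≤ m₂ → pWitness ∈ᵇ ideal (a , b) ≡ true
  pWitness∈ a< b≤ = residue∈ideal s m₂ pWitness< (s≤s⁻¹ a<) b≤

  qWitness∈ : ∀ {a b} → a ≤ m₁ → b < m₂ → qWitness ∈ᵇ ideal (a , b) ≡ true
  qWitness∈ a≤ b< = residue∈ideal m₁ t qWitness< a≤ (s≤s⁻¹ b<)

  pWitness≢0 : toℕ pWitness ≢ 0
  pWitness≢0 = residue≢0 s m₂ pWitness<

  qWitness≢0 : toℕ qWitness ≢ 0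
  qWitness≢0 = residue≢0 m₁ t qWitness<

  essential-apart : ∀ {c c′} → InBox c → InBox c′ → Apart c c′ → isEssential (ideal c ⊕ ideal c′) ≡ true
  essential-apart {a , b} {a′ , b′} (a≤ , b≤) (a′≤ , b′≤) (a<∨a′< , b<∨b′<) = essential⁺ {S = S} meets
    where
    S : Subset n
    S = ideal (a , b) ⊕ ideal (a′ , b′)
    pWitness∈S : pWitness ∈ᵇ S ≡ true
    pWitness∈S = [ (λ a< → ∈-⊕ˡ {ideal (a , b)} {ideal (a′ , b′)} pWitness (pWitness∈ a< b≤) (0∈ideal (a′ , b′)))
                 , (λ a′< → ∈-⊕ʳ {ideal (a , b)} {ideal (a′ , b′)} pWitness (0∈ideal (a , b)) (pWitness∈ a′< b′≤))
                 ]′ a<∨a′<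
    qWitness∈S : qWitness ∈ᵇ S ≡ true
    qWitness∈S = [ (λ b< → ∈-⊕ˡ {ideal (a , b)} {ideal (a′ , b′)} qWitness (qWitness∈ a≤ b<) (0∈ideal (a′ , b′)))
                 , (λ b′< → ∈-⊕ʳ {ideal (a , b)} {ideal (a′ , b′)} qWitness (0∈ideal (a , b)) (qWitness∈ a′≤ b′<))
                 ]′ b<∨b′<
    meets : ∀ {J} → J ∈ ideals n → isNonzero J ≡ true → isNonzero (S ∩ J) ≡ true
    meets J∈ J≠0 with ideal-coords J∈
    ... | (a₀ , b₀) , (a₀≤ , b₀≤) , refl with m≤n⇒m<n∨m≡n a₀≤
    ...   | inj₁ a₀< = nonzero⁺ {I = S ∩ ideal (a₀ , b₀)} pWitness
            (trans (∈-∩ S (ideal (a₀ , b₀)) pWitness) (cong₂ _∧_ pWitness∈S (pWitness∈ a₀< b₀≤))) pWitness≢0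
    ...   | inj₂ refl = nonzero⁺ {I = S ∩ ideal (m₁ , b₀)} qWitness
            (trans (∈-∩ S (ideal (m₁ , b₀)) qWitness) (cong₂ _∧_ qWitness∈S (qWitness∈ ≤-refl b₀<))) qWitness≢0
      where
      b₀< : b₀ < m₂
      b₀< = ≤∧≢⇒< b₀≤ λ { refl → case trans (sym J≠0) ideal-top-zero of λ () }

  inessential : ∀ {S : Subset n} {a b} → InBox (a , b) → (a , b) ≢ (m₁ , m₂) →
    (∀ x → x ∈ᵇ S ≡ true → D a b ∣ toℕ x → n ∣ toℕ x) → isEssential S ≡ false
  inessential {S} {a} {b} (a≤ , b≤) ≢top meet⊆n =
    essential-false {S = S} {ideal (a , b)} (∈-ideals⁺ (multiples-ideal (D∣n a≤ b≤))) (multiples-nonzero (D∣n a≤ b≤) (D<n (a≤ , b≤) ≢top))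
      λ x x∈S x∈J → n∣∧<n⇒≡0 (meet⊆n x x∈S (∈-multiples⁻ x x∈J)) (toℕ<n x)

  essential-aligned : ∀ {c c′} → Aligned c c′ → isEssential (ideal c ⊕ ideal c′) ≡ false
  essential-aligned {a , b} {a′ , b′} (inj₁ (refl , refl)) =
    inessential {S = ideal (a , b) ⊕ ideal (a′ , b′)} {0} {m₂} (z≤n , ≤-refl) (λ ()) λ x x∈S q^m₂∣x →
      subst (_∣ toℕ x) n≡ (^∣∧^∣⇒D∣ {m₁} {m₂} (∣-multiples-⊕ x (m∣m*n (q ^ b)) (m∣m*n (q ^ b′)) p^m₁∣n x∈S)
                                   (subst (_∣ toℕ x) (*-identityˡ (q ^ m₂)) q^m₂∣x))
    where
    p^m₁∣n : p ^ m₁ ∣ n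
    p^m₁∣n = subst (p ^ m₁ ∣_) n≡ (m∣m*n (q ^ m₂))
  essential-aligned {a , b} {a′ , b′} (inj₂ (refl , refl)) =
    inessential {S = ideal (a , b) ⊕ ideal (a′ , b′)} {m₁} {0} (≤-refl , z≤n) (λ ()) λ x x∈S p^m₁∣x →
      subst (_∣ toℕ x) n≡ (^∣∧^∣⇒D∣ {m₁} {m₂} (subst (_∣ toℕ x) (*-identityʳ (p ^ m₁)) p^m₁∣x)
                                   (∣-multiples-⊕ x (n∣m*n (p ^ a)) (n∣m*n (p ^ a′)) q^m₂∣n x∈S))
    where
    q^m₂∣n : q ^ m₂ ∣ n
    q^m₂∣n = subst (q ^ m₂ ∣_) n≡ (n∣m*n (p ^ m₁))

  adj-ideal : ∀ {c c′} → InBox c → InBox c′ → c ≢ c′ → adj (ideal c) (ideal c′) ≡ isEssential (ideal c ⊕ ideal c′)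
  adj-ideal c∈ c′∈ c≢c′ rewrite eqSubset-≢ (ideal-≢ c∈ c′∈ c≢c′) = refl

  dd : Coord → Coord → ℕ
  dd c c′ = dist n (ideal c) (ideal c′)

  dd-apart : ∀ {c c′} → IsVertex c → IsVertex c′ → c ≢ c′ → Apart c c′ → dd c c′ ≡ 1
  dd-apart c-vertex@(c∈ , _) (c′∈ , _) c≢c′ apart =
    dist-adjacent 2≤|V| (ideal∈V c-vertex) (ideal-≢ c∈ c′∈ c≢c′)
      (trans (adj-ideal c∈ c′∈ c≢c′) (essential-apart c∈ c′∈ apart))

  dd-common-neighbour : ∀ {c c′} w → IsVertex c → IsVertex c′ → IsVertex w → c ≢ c′ → Aligned c c′ →
    c ≢ w → Apart c w → w ≢ c′ → Apart w c′ → dd c c′ ≡ 2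
  dd-common-neighbour w c-vertex@(c∈ , _) (c′∈ , _) w-vertex@(w∈ , _) c≢c′ aligned c≢w c-w w≢c′ w-c′ =
    dist-common-neighbour 2≤|V| (ideal∈V c-vertex) (ideal∈V w-vertex) (ideal-≢ c∈ c′∈ c≢c′)
      (trans (adj-ideal c∈ c′∈ c≢c′) (essential-aligned aligned))
      (trans (adj-ideal c∈ w∈ c≢w) (essential-apart c∈ w∈ c-w))
      (trans (adj-ideal w∈ c′∈ w≢c′) (essential-apart w∈ c′∈ w-c′))

  <m₂-of-vertex : ∀ {b} → IsVertex (m₁ , b) → b < m₂
  <m₂-of-vertex ((_ , b≤) , _ , ≢top) = ≤∧≢⇒< b≤ λ { refl → ≢top refl }

  <m₁-of-vertex : ∀ {a} → IsVertex (a , m₂) → a < m₁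
  <m₁-of-vertex ((a≤ , _) , _ , ≢top) = ≤∧≢⇒< a≤ λ { refl → ≢top refl }

  dd-aligned : ∀ {c c′} → IsVertex c → IsVertex c′ → c ≢ c′ → Aligned c c′ → dd c c′ ≡ 2
  dd-aligned {a , b} {a′ , b′} c-vertex c′-vertex c≢c′ aligned@(inj₁ (refl , refl)) =
    dd-common-neighbour (0 , m₂) c-vertex c′-vertex ((z≤n , ≤-refl) , (λ ()) , λ ()) c≢c′ aligned
      (λ ()) (inj₂ (s≤s z≤n) , inj₁ (<m₂-of-vertex c-vertex)) (λ ()) (inj₁ (s≤s z≤n) , inj₂ (<m₂-of-vertex c′-vertex))
  dd-aligned {a , b} {a′ , b′} c-vertex c′-vertex c≢c′ aligned@(inj₂ (refl , refl)) =
    dd-common-neighbour (m₁ , 0) c-vertex c′-vertex ((≤-refl , z≤n) , (λ ()) , λ ()) c≢c′ aligned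
      (λ ()) (inj₁ (<m₁-of-vertex c-vertex) , inj₂ (s≤s z≤n)) (λ ()) (inj₂ (<m₁-of-vertex c′-vertex) , inj₁ (s≤s z≤n))

  dd-sym : ∀ {c c′} → IsVertex c → IsVertex c′ → dd c c′ ≡ dd c′ c
  dd-sym {c} {c′} c-vertex c′-vertex with ≡-dec _≟_ _≟_ c c′
  ... | yes refl = refl
  ... | no c≢c′ with apart-or-aligned (proj₁ c-vertex) (proj₁ c′-vertex)
  ...   | inj₁ apart = trans (dd-apart c-vertex c′-vertex c≢c′ apart)
                             (sym (dd-apart c′-vertex c-vertex (c≢c′ ∘′ sym) (Apart-sym {c} apart)))
  ...   | inj₂ aligned = trans (dd-aligned c-vertex c′-vertex c≢c′ aligned)
                               (sym (dd-aligned c′-vertex c-vertex (c≢c′ ∘′ sym) (Sum.map Prod.swap Prod.swap aligned)))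

  wiener≡pairSum : wienerEssential n ≡ pairSum dd coords
  wiener≡pairSum = trans (pairSum-↭ (dist n) dist-sym V↭ideals) (pairSum-map (dist n) ideal coords)
    where
    dist-sym : ∀ {u v} → u ∈ V → v ∈ V → dist n u v ≡ dist n v u
    dist-sym u∈ v∈ with V⇒ideal u∈ | V⇒ideal v∈
    ... | c , c-vertex , refl | c′ , c′-vertex , refl = dd-sym c-vertex c′-vertex

  private
    dd-apart-coords : ∀ {c c′} → c ∈ coords → c′ ∈ coords → c ≢ c′ → Apart c c′ → dd c c′ ≡ 1
    dd-apart-coords c∈ c′∈ = dd-apart (∈coords⁻ c∈) (∈coords⁻ c′∈)

    qFull⊆ : ∀ {c} → c ∈ qFull → c ∈ coords
    qFull⊆ = ∈-++⁺ʳ pFull ∘′ ∈-++⁺ˡ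

    interior⊆ : ∀ {c} → c ∈ interior → c ∈ coords
    interior⊆ = ∈-++⁺ʳ pFull ∘′ ∈-++⁺ʳ qFull

  pFull-pairs : ∀ {c c′} → c ∈ pFull → c′ ∈ pFull → c ≢ c′ → dd c c′ ≡ 2
  pFull-pairs c∈ c′∈ c≢c′ = dd-aligned (∈coords⁻ (∈-++⁺ˡ c∈)) (∈coords⁻ (∈-++⁺ˡ c′∈)) c≢c′
    (inj₁ (proj₁ (∈pFull⁻ c∈) , proj₁ (∈pFull⁻ c′∈)))

  qFull-pairs : ∀ {c c′} → c ∈ qFull → c′ ∈ qFull → c ≢ c′ → dd c c′ ≡ 2
  qFull-pairs c∈ c′∈ c≢c′ = dd-aligned (∈coords⁻ (qFull⊆ c∈)) (∈coords⁻ (qFull⊆ c′∈)) c≢c′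
    (inj₂ (proj₂ (∈qFull⁻ c∈) , proj₂ (∈qFull⁻ c′∈)))

  interior-pairs : ∀ {c c′} → c ∈ interior → c′ ∈ interior → c ≢ c′ → dd c c′ ≡ 1
  interior-pairs c∈ c′∈ c≢c′ = dd-apart-coords (interior⊆ c∈) (interior⊆ c′∈) c≢c′
    (inj₁ (proj₁ (∈interior⁻ c∈)) , inj₁ (proj₁ (proj₂ (∈interior⁻ c∈))))

  qFull-interior : ∀ {c c′} → c ∈ qFull → c′ ∈ interior → dd c c′ ≡ 1
  qFull-interior {c} {c′} c∈ c′∈ = dd-apart-coords (qFull⊆ c∈) (interior⊆ c′∈)
    (λ c≡c′ → <⇒≢ b′< (trans (sym (cong proj₂ c≡c′)) (proj₂ (∈qFull⁻ c∈))))
    (inj₁ (proj₁ (∈qFull⁻ c∈)) , inj₂ b′<)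
    where
    b′< : proj₂ c′ < m₂
    b′< = proj₁ (proj₂ (∈interior⁻ c′∈))

  pFull-rest : ∀ {c c′} → c ∈ pFull → c′ ∈ qFull ++ interior → dd c c′ ≡ 1
  pFull-rest {c} {c′} c∈ c′∈ = dd-apart-coords (∈-++⁺ˡ c∈) (∈-++⁺ʳ pFull c′∈)
    (λ c≡c′ → <⇒≢ a′< (trans (sym (cong proj₁ c≡c′)) (proj₁ (∈pFull⁻ c∈))))
    (inj₂ a′< , inj₁ (proj₂ (∈pFull⁻ c∈)))
    where
    a′< : proj₁ c′ < m₁
    a′< = [ proj₁ ∘′ ∈qFull⁻ , proj₁ ∘′ ∈interior⁻ ]′ (∈-++⁻ qFull c′∈)

  wiener-formula : wienerEssential n ≡ choose2 (m₂ + (m₁ + r)) + choose2 m₂ + choose2 m₁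
  wiener-formula = begin
    wienerEssential n
      ≡⟨ wiener≡pairSum ⟩
    pairSum dd (pFull ++ qFull ++ interior)
      ≡⟨ pairSum-++ dd pFull (qFull ++ interior) ⟩
    pairSum dd pFull + pairSum dd (qFull ++ interior) + crossSum dd pFull (qFull ++ interior)
      ≡⟨ cong (λ x → pairSum dd pFull + x + crossSum dd pFull (qFull ++ interior)) (pairSum-++ dd qFull interior) ⟩
    pairSum dd pFull + (pairSum dd qFull + pairSum dd interior + crossSum dd qFull interior)
      + crossSum dd pFull (qFull ++ interior)
      ≡⟨ cong₂ _+_ (cong₂ _+_ pFull-sum (cong₂ _+_ (cong₂ _+_ qFull-sum interior-sum) qFull-interior-sum)) pFull-rest-sum ⟩
    2 * choose2 m₂ + (2 * choose2 m₁ + 1 * choose2 r + 1 * (m₁ * r)) + 1 * (m₂ * (m₁ + r))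
      ≡⟨ regroup (choose2 m₁) (choose2 m₂) (choose2 r) m₁ m₂ r ⟩
    choose2 m₂ + (choose2 m₁ + choose2 r + m₁ * r) + m₂ * (m₁ + r) + choose2 m₂ + choose2 m₁
      ≡⟨ cong (λ x → choose2 m₂ + x + m₂ * (m₁ + r) + choose2 m₂ + choose2 m₁) (choose2-+ m₁ r) ⟨
    choose2 m₂ + choose2 (m₁ + r) + m₂ * (m₁ + r) + choose2 m₂ + choose2 m₁
      ≡⟨ cong (λ x → x + choose2 m₂ + choose2 m₁) (choose2-+ m₂ (m₁ + r)) ⟨
    choose2 (m₂ + (m₁ + r)) + choose2 m₂ + choose2 m₁ ∎
    where
    open ≡-Reasoning
    pFull-sum : pairSum dd pFull ≡ 2 * choose2 m₂
    pFull-sum = trans (pairSum-const dd 2 pFull (Unique.map⁺ (cong proj₂) (Unique.upTo⁺ m₂)) pFull-pairs)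
                      (cong (λ l → 2 * choose2 l) length-pFull)
    qFull-sum : pairSum dd qFull ≡ 2 * choose2 m₁
    qFull-sum = trans (pairSum-const dd 2 qFull (Unique.map⁺ (cong proj₁) (Unique.upTo⁺ m₁)) qFull-pairs)
                      (cong (λ l → 2 * choose2 l) length-qFull)
    interior-sum : pairSum dd interior ≡ 1 * choose2 r
    interior-sum = trans (pairSum-const dd 1 interior (Unique.drop⁺ 1 grid-unique) interior-pairs)
                         (cong (λ l → 1 * choose2 l) length-interior)
    qFull-interior-sum : crossSum dd qFull interior ≡ 1 * (m₁ * r)
    qFull-interior-sum = trans (crossSum-const dd 1 qFull interior qFull-interior)
                               (cong₂ (λ x y → 1 * (x * y)) length-qFull length-interior)
    pFull-rest-sum : crossSum dd pFull (qFull ++ interior) ≡ 1 * (m₂ * (m₁ + r))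
    pFull-rest-sum = trans (crossSum-const dd 1 pFull (qFull ++ interior) pFull-rest)
                           (cong₂ (λ x y → 1 * (x * y)) length-pFull (trans (length-++ qFull) (cong₂ _+_ length-qFull length-interior)))
    regroup : ∀ x₁ x₂ xᵣ a b c → 2 * x₂ + (2 * x₁ + 1 * xᵣ + 1 * (a * c)) + 1 * (b * (a + c))
                                ≡ x₂ + (x₁ + xᵣ + a * c) + b * (a + c) + x₂ + x₁
    regroup = solve-∀

mainTheorem13 : (p q m₁ m₂ : ℕ) → Prime p → Prime q → p < q → 1 ≤ m₁ → 1 ≤ m₂ →
    + 2 *ℤ + wienerEssential (p ^ m₁ * q ^ m₂)
      ≡ (+ m₁ *ℤ + m₂) *ℤ (+ m₁ *ℤ + m₂ -ℤ + 1)
        +ℤ (+ m₁ +ℤ + m₂) *ℤ (+ 2 *ℤ + m₁ *ℤ + m₂ -ℤ + 4)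
        +ℤ + 2 *ℤ (+ 1 +ℤ + m₁ *ℤ + m₁ +ℤ + m₂ *ℤ + m₂)
mainTheorem13 p q (suc s) (suc t) p-prime q-prime p<q _ _ with p ^ suc s * q ^ suc t in n≡
... | zero = ⊥-elim (TwoPrimePowers.D≢0 p-prime q-prime (<⇒≢ p<q) (suc s) (suc t) n≡)
... | suc k = trans (cong (λ w → + 2 *ℤ + w) wiener-formula) (wiener-arith (suc s) (suc t) r refl)
  where open EssentialIdealGraph p-prime q-prime (<⇒≢ p<q) s t k n≡
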